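{- The proof system D-QU-Res is not refutationally complete for DQBF: there exists a false DQBF with CNF matrix (for instance $\forall x_1\forall x_1'\forall x_2\forall x_2'\,\exists y_1(x_1,x_1')\,\exists y_2(x_2,x_2')$ with matrix consisting of the clauses $\{y_1,y_2,x_1,x_1'\}$, $\{\neg y_1,\neg y_2,x_1,x_1'\}$, $\{y_1,y_2,\neg x_1,\neg x_1',\neg x_2,\neg x_2'\}$, $\{\neg y_1,\neg y_2,\neg x_1,\neg x_1',\neg x_2,\neg x_2'\}$, $\{y_1,\neg y_2,\neg x_1,\neg x_1',x_2,x_2'\}$, $\{\neg y_1,y_2,\neg x_1,\neg x_1',x_2,x_2'\}$) from which the empty clause cannot be derived in D-QU-Res.
   Context: A DQBF has universal variables $Y$, existential variables $X$, a dependency set $Y_x\subseteq Y$ for each $x\in X$ (written $\exists x(Y_x)$), and a CNF matrix over $X\cup Y$ (clauses are sets of literals). It is true iff there are Skolem functions $f_x:\{0,1\}^{Y_x}\to\{0,1\}$ such that for every $\alpha:Y\to\{0,1\}$ the matrix evaluates to $1$ under $\alpha$ extended by $x\mapsto f_x(\alpha\restriction Y_x)$; otherwise false. D-QU-Res (the lifting of QU-resolution to DQBF, obtained by reading the QBF index condition "$\mathrm{ind}(y)<\mathrm{ind}(x)$" as "$y\in Y_x$") derives clauses by: (Axiom) any clause of the matrix; ($\forall$-Red) from $D\cup\{u\}$ with $u$ a universal literal derive $D$, provided $\mathrm{var}(u)\notin Y_{\mathrm{var}(l)}$ for every existential literal $l\in D$; (Resolution) from $C_1\cup\{x\}$ and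 $C_2\cup\{\neg x\}$, where $x$ is any (existential or universal) variable and there is no variable $z$ with $z\in C_1$ and $\neg z\in C_2$, derive $C_1\cup C_2$. -}

module Defs where

open import Data.Nat using (ℕ)
open import Data.Bool using (Bool; true; false; not)
import Data.Bool.Properties as BoolP
open import Data.Fin using (Fin)
import Data.Fin.Properties as FinP
open import Data.Fin.Subset using (Subset; _∈_; _∉_)
open import Data.Sum using (_⊎_; inj₁; inj₂)
import Data.Sum.Properties as SumP
open import Data.Product using (Σ; _×_; _,_; proj₁; proj₂; ∃)
import Data.Product.Properties as ProdP
open import Data.List using (List; []; _∷_; _++_; filter)
open import Data.List.Relation.Unary.All using (All)
open import Data.List.Relation.Unary.Any using (Any)
import Data.List.Membership.Propositional as Mem
open import Relation.Nullary using (¬_; ¬?)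
open import Relation.Binary.Definitions using (DecidableEquality)
open import Relation.Binary.PropositionalEquality using (_≡_)

-- A clause (a set of literals) is represented by a list of literals;
-- every notion below (satisfaction, rule side-conditions, emptiness)
-- only depends on list membership, so this is faithful to set semantics.

record DQBF : Set where
  field
    nU     : ℕ
    nE     : ℕ
    dep    : Fin nE → Subset nU
    matrix : List (List (Bool × (Fin nU ⊎ Fin nE)))

module _ (Φ : DQBF) where
  open DQBF Φ

  Var : Set
  Var = Fin nU ⊎ Fin nE

  -- a literal is (polarity , variable); polarity true = positive literal
  Lit : Set
  Lit = Bool × Var

  Clause : Set
  Clause = List Lit

  var : Lit → Var
  var = proj₂

  neg : Lit → Lit
  neg (b , v) = (not b , v)

  _≟L_ : DecidableEquality Lit
  _≟L_ = ProdP.≡-dec BoolP._≟_ (SumP.≡-dec FinP._≟_ FinP._≟_)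

  remove : Lit → Clause → Clause
  remove l C = filter (λ m → ¬? (m ≟L l)) C

  -- Semantics.
  -- Universal assignment α : Fin nU → Bool; Skolem functions
  -- f x : (Fin nU → Bool) → Bool that only depend on α restricted to Y_x.

  Assignment : Set
  Assignment = Fin nU → Bool

  DependsOnlyOn : Subset nU → (Assignment → Bool) → Set
  DependsOnlyOn Y g =
    ∀ (α β : Assignment) → (∀ y → y ∈ Y → α y ≡ β y) → g α ≡ g β

  valueVar : Assignment → (Fin nE → Assignment → Bool) → Var → Bool
  valueVar α f (inj₁ y) = α y
  valueVar α f (inj₂ x) = f x α

  LitTrue : Assignment → (Fin nE → Assignment → Bool) → Lit → Set
  LitTrue α f (b , v) = valueVar α f v ≡ b

  ClauseTrue : Assignment → (Fin nE → Assignment → Bool) → Clause → Set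
  ClauseTrue α f C = Any (LitTrue α f) C

  IsTrue : Set
  IsTrue = Σ (Fin nE → Assignment → Bool) λ f →
             (∀ x → DependsOnlyOn (dep x) (f x)) ×
             (∀ (α : Assignment) → All (ClauseTrue α f) matrix)

  open Mem using () renaming (_∈_ to _∈L_)

  ReducibleFrom : Fin nU → Clause → Set
  ReducibleFrom u D = ∀ (b : Bool) (x : Fin nE) → (b , inj₂ x) ∈L D → u ∉ dep x

  NoClash : Clause → Clause → Set
  NoClash C₁ C₂ = ∀ l → l ∈L C₁ → ¬ (neg l ∈L C₂)

  data Derivable : Clause → Set where
    axiom : ∀ {C} → C ∈L matrix → Derivable C
    ∀-red : ∀ {C} (b : Bool) (u : Fin nU) →
            Derivable C → (b , inj₁ u) ∈L C →
            ReducibleFrom u (remove (b , inj₁ u) C) →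
            Derivable (remove (b , inj₁ u) C)
    res   : ∀ {C C'} (v : Var) →
            Derivable C → Derivable C' →
            (true , v) ∈L C → (false , v) ∈L C' →
            NoClash (remove (true , v) C) (remove (false , v) C') →
            Derivable (remove (true , v) C ++ remove (false , v) C')

-- A D-QU-Res refutation has to start from a rule application on matrix
-- clauses, and in the counterexample none is possible: every universal
-- literal of a clause lies in the dependency set of an existential literal of
-- the same clause, and any two clauses with a complementary pair of literals
-- have a second one.  So the derivable clauses are exactly the matrix clauses.
--
-- The formula is false because y₁ sees only x₁x₁' and y₂ only x₂x₂'.  On the
-- assignments with x₁ = x₁' = s and x₂ = x₂' = t the Skolem functions become
-- a(s) and b(t), and the matrix demands a(0) ≠ b(t) for both t, a(1) ≠ b(1)
-- and a(1) = b(0); the first gives b(0) = b(1), contradicting the others.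
module Submission where

open import Defs
open import Data.List using ([])
open import Data.Product using (∃; _×_)
open import Relation.Nullary using (¬_)

open import Data.Bool using (Bool; true; false; not; if_then_else_; _∨_; T)
open import Data.Bool.Properties using (T-≡; T-not-≡; not-injective; not-¬)
open import Data.Empty using (⊥)
open import Data.Fin using (Fin; zero; suc)
open import Data.Fin.Subset using (Subset) renaming (_∈_ to _∈ₛ_)
open import Data.Fin.Subset.Properties using () renaming (_∈?_ to _∈ₛ?_)
open import Data.List using (_∷_)
open import Data.Bool.ListAction using (any)
open import Data.List.Membership.Propositional using (_∈_)
import Data.List.Membership.DecPropositional as DecMembership
open import Data.List.Relation.Unary.All as All using (All; _∷_)
open import Data.List.Relation.Unary.Any as Any using (Any; here; there)
open import Data.List.Relation.Unary.Any.Properties using (any⁺)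
open import Data.Product using (_,_)
open import Data.Sum using (inj₁; inj₂)
open import Data.Unit using (⊤)
open import Data.Vec as Vec using (_∷_; [])
open import Function using (_∘_)
open import Function.Bundles using (Equivalence)
open import Relation.Nullary using (Dec; yes; no)
open import Relation.Nullary.Decidable using (toWitness; _→-dec_; _×-dec_)
open import Relation.Binary.PropositionalEquality using (_≡_; refl; sym; trans; subst₂)

module _ {Φ : DQBF} where
  open DQBF Φ

  DependsOn : Fin nU → Lit Φ → Set
  DependsOn u (_ , inj₁ _) = ⊥
  DependsOn u (_ , inj₂ x) = u ∈ₛ dep x

  Clashes : Clause Φ → Clause Φ → Set
  Clashes A B = Any (λ l → neg Φ l ∈ B) A

  ReductionBlocked : Clause Φ → Lit Φ → Set
  ReductionBlocked C (b , inj₁ u) = Any (DependsOn u) (remove Φ (b , inj₁ u) C)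
  ReductionBlocked C (_ , inj₂ _) = ⊤

  ResolutionBlocked : Clause Φ → Clause Φ → Lit Φ → Set
  ResolutionBlocked C C′ (true  , v) =
    (false , v) ∈ C′ → Clashes (remove Φ (true , v) C) (remove Φ (false , v) C′)
  ResolutionBlocked C C′ (false , _) = ⊤

  Inert : Set
  Inert = All (λ C → All (ReductionBlocked C) C) matrix
        × All (λ C → All (λ C′ → All (ResolutionBlocked C C′) C) matrix) matrix

  dependsOn-¬reducible : ∀ {u D} → Any (DependsOn u) D → ¬ ReducibleFrom Φ u D
  dependsOn-¬reducible {D = (_ , inj₁ _) ∷ _} (here ())
  dependsOn-¬reducible {D = (b , inj₂ x) ∷ _} (here u∈Yₓ) red = red b x (here refl) u∈Yₓ
  dependsOn-¬reducible (there depends) red = dependsOn-¬reducible depends (λ b x → red b x ∘ there)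

  clashes-¬noClash : ∀ {A B} → Clashes A B → ¬ NoClash Φ A B
  clashes-¬noClash (here clash)  noClash = noClash _ (here refl) clash
  clashes-¬noClash (there clash) noClash = clashes-¬noClash clash (λ l → noClash l ∘ there)

  derivable⇒∈matrix : Inert → ∀ {C} → Derivable Φ C → C ∈ matrix
  derivable⇒∈matrix _ (axiom C∈M) = C∈M
  derivable⇒∈matrix inert@(blocked , _) (∀-red b u d u∈C red)
    with () ← dependsOn-¬reducible
      (All.lookup (All.lookup blocked (derivable⇒∈matrix inert d)) u∈C)
      red
  derivable⇒∈matrix inert@(_ , blocked) (res v d d′ v∈C ¬v∈C′ noClash)
    with () ← clashes-¬noClash
      (All.lookup (All.lookup (All.lookup blocked (derivable⇒∈matrix inert d))
                                                  (derivable⇒∈matrix inert d′)) v∈C ¬v∈C′)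
      noClash

  open DecMembership (_≟L_ Φ) using (_∈?_)

  dependsOn? : ∀ u l → Dec (DependsOn u l)
  dependsOn? u (_ , inj₁ _) = no λ ()
  dependsOn? u (_ , inj₂ x) = u ∈ₛ? dep x

  clashes? : ∀ A B → Dec (Clashes A B)
  clashes? A B = Any.any? (λ l → neg Φ l ∈? B) A

  reductionBlocked? : ∀ C l → Dec (ReductionBlocked C l)
  reductionBlocked? C (b , inj₁ u) = Any.any? (dependsOn? u) (remove Φ (b , inj₁ u) C)
  reductionBlocked? C (_ , inj₂ _) = yes _

  resolutionBlocked? : ∀ C C′ l → Dec (ResolutionBlocked C C′ l)
  resolutionBlocked? C C′ (true  , v) =
    ((false , v) ∈? C′) →-dec clashes? (remove Φ (true , v) C) (remove Φ (false , v) C′)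
  resolutionBlocked? C C′ (false , _) = yes _

  inert? : Dec Inert
  inert? = All.all? (λ C → All.all? (reductionBlocked? C) C) matrix
    ×-dec All.all? (λ C → All.all? (λ C′ → All.all? (resolutionBlocked? C C′) C) matrix) matrix

  litValue : Assignment Φ → (Fin nE → Assignment Φ → Bool) → Lit Φ → Bool
  litValue α f (b , v) = if b then valueVar Φ α f v else not (valueVar Φ α f v)

  litTrue⇒T-litValue : ∀ {α f} l → LitTrue Φ α f l → T (litValue α f l)
  litTrue⇒T-litValue (true  , _) = Equivalence.from T-≡
  litTrue⇒T-litValue (false , _) = Equivalence.from T-not-≡

  clauseTrue⇒T-any : ∀ {α f C} → ClauseTrue Φ α f C → T (any (litValue α f) C)
  clauseTrue⇒T-any = any⁺ _ ∘ Any.map (λ {l} → litTrue⇒T-litValue l)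

xor-clauses⇒≡not : ∀ p q → T (p ∨ q ∨ false) → T (not p ∨ not q ∨ false) → p ≡ not q
xor-clauses⇒≡not true  false _ _ = refl
xor-clauses⇒≡not false true  _ _ = refl

xnor-clauses⇒≡ : ∀ p q → T (p ∨ not q ∨ false) → T (not p ∨ q ∨ false) → p ≡ q
xnor-clauses⇒≡ true  true  _ _ = refl
xnor-clauses⇒≡ false false _ _ = refl

odd-cycle-unsatisfiable : (a b : Bool → Bool) →
  (∀ t → a false ≡ not (b t)) → a true ≡ not (b true) → a true ≡ b false → ⊥
odd-cycle-unsatisfiable a b a₀≢b a₁≢b₁ a₁≡b₀ = not-¬ (trans a₁≡b₀ b₀≡b₁) a₁≢b₁
  where
  b₀≡b₁ : b false ≡ b true
  b₀≡b₁ = not-injective (trans (sym (a₀≢b false)) (a₀≢b true))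

pattern x₁  = inj₁ zero
pattern x₁′ = inj₁ (suc zero)
pattern x₂  = inj₁ (suc (suc zero))
pattern x₂′ = inj₁ (suc (suc (suc zero)))
pattern y₁  = inj₂ zero
pattern y₂  = inj₂ (suc zero)

dependencies : Fin 2 → Subset 4
dependencies zero       = true  ∷ true  ∷ false ∷ false ∷ []
dependencies (suc zero) = false ∷ false ∷ true  ∷ true  ∷ []

counterexample : DQBF
counterexample = record
  { nU = 4 ; nE = 2 ; dep = dependencies
  ; matrix = ((true  , y₁) ∷ (true  , y₂) ∷ (true  , x₁) ∷ (true  , x₁′) ∷ [])
           ∷ ((false , y₁) ∷ (false , y₂) ∷ (true  , x₁) ∷ (true  , x₁′) ∷ [])
           ∷ ((true  , y₁) ∷ (true  , y₂) ∷ (false , x₁) ∷ (false , x₁′) ∷ (false , x₂) ∷ (false , x₂′) ∷ [])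
           ∷ ((false , y₁) ∷ (false , y₂) ∷ (false , x₁) ∷ (false , x₁′) ∷ (false , x₂) ∷ (false , x₂′) ∷ [])
           ∷ ((true  , y₁) ∷ (false , y₂) ∷ (false , x₁) ∷ (false , x₁′) ∷ (true  , x₂) ∷ (true  , x₂′) ∷ [])
           ∷ ((false , y₁) ∷ (true  , y₂) ∷ (false , x₁) ∷ (false , x₁′) ∷ (true  , x₂) ∷ (true  , x₂′) ∷ [])
           ∷ []
  }

counterexample-inert : Inert {counterexample}
counterexample-inert = toWitness {a? = inert?} _

counterexample-irrefutable : ¬ Derivable counterexample []
counterexample-irrefutable d with derivable⇒∈matrix counterexample-inert d
... | there (there (there (there (there (there ())))))

diagonal : Bool → Bool → Assignment counterexample
diagonal s t zero          = s
diagonal s t (suc zero)    = s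
diagonal s t (suc (suc _)) = t

module _ (f : Fin 2 → Assignment counterexample → Bool)
         (indep : ∀ x → DependsOnlyOn counterexample (dependencies x) (f x)) where

  a b : Bool → Bool
  a s = f zero (diagonal s false)
  b t = f (suc zero) (diagonal false t)

  y₁-value : ∀ s t → f zero (diagonal s t) ≡ a s
  y₁-value s t = indep zero _ _ agree
    where
    agree : ∀ y → y ∈ₛ dependencies zero → diagonal s t y ≡ diagonal s false y
    agree zero                   _ = refl
    agree (suc zero)             _ = refl
    agree (suc (suc zero))       (Vec.there (Vec.there ()))
    agree (suc (suc (suc zero))) (Vec.there (Vec.there (Vec.there ())))

  y₂-value : ∀ s t → f (suc zero) (diagonal s t) ≡ b t
  y₂-value s t = indep (suc zero) _ _ agree
    where
    agree : ∀ y → y ∈ₛ dependencies (suc zero) → diagonal s t y ≡ diagonal false t y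
    agree zero          ()
    agree (suc zero)    (Vec.there ())
    agree (suc (suc _)) _ = refl

  along-diagonal : (R : Bool → Bool → Set) → ∀ s t →
                   R (f zero (diagonal s t)) (f (suc zero) (diagonal s t)) → R (a s) (b t)
  along-diagonal R s t = subst₂ R (y₁-value s t) (y₂-value s t)

counterexample-false : ¬ IsTrue counterexample
counterexample-false (f , indep , sat) =
  odd-cycle-unsatisfiable (a f indep) (b f indep) a₀≢b a₁≢b₁ a₁≡b₀
  where
  values : ∀ s t → All (T ∘ any (litValue (diagonal s t) f)) (DQBF.matrix counterexample)
  values s t = All.map clauseTrue⇒T-any (sat (diagonal s t))

  a₀≢b : ∀ t → a f indep false ≡ not (b f indep t)
  a₀≢b t with c₁ ∷ c₂ ∷ _ ← values false t =
    along-diagonal f indep (λ p q → p ≡ not q) false t (xor-clauses⇒≡not _ _ c₁ c₂)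

  a₁≢b₁ : a f indep true ≡ not (b f indep true)
  a₁≢b₁ with _ ∷ _ ∷ c₃ ∷ c₄ ∷ _ ← values true true =
    along-diagonal f indep (λ p q → p ≡ not q) true true (xor-clauses⇒≡not _ _ c₃ c₄)

  a₁≡b₀ : a f indep true ≡ b f indep false
  a₁≡b₀ with _ ∷ _ ∷ _ ∷ _ ∷ c₅ ∷ c₆ ∷ _ ← values true false =
    along-diagonal f indep _≡_ true false (xnor-clauses⇒≡ _ _ c₅ c₆)

mainTheorem4 : ∃ λ (Φ : DQBF) → ¬ IsTrue Φ × ¬ Derivable Φ []
mainTheorem4 = counterexample , counterexample-false , counterexample-irrefutable
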